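{- Let $G=(V,E)$ be a finite graph with $n=|V|$ vertices, and let $d_v$ denote the degree of vertex $v$. Then, as an identity of rational functions in $a_0,a_1,a_2$, $$M_G(a_0,a_1,a_2)=a_0^{|E|-n}\sum_{M\in\mathcal{M}(G)}(a_0a_2-a_1^2)^{|M|}\prod_{v\notin V(M)}(a_0+d_va_1).$$
   Context: Each edge of $G$ is regarded as consisting of two half-edges, one at each endpoint. A half-edge configuration is a choice of a set of half-edges such that every vertex of $G$ is incident to at most one chosen half-edge (an edge both of whose halves are chosen counts as a chosen edge, so each vertex is incident to at most one chosen edge or half-edge). For a configuration $C$, let $C_0$, $C_1$, $C_2$ be the number of edges of $G$ of which $0$, exactly $1$, respectively $2$ halves are chosen. Define $M_G(a_0,a_1,a_2)=\sum_C a_0^{C_0}a_1^{C_1}a_2^{C_2}$, summing over all half-edge configurations. $\mathcal{M}(G)$ is the set of matchings of $G$ (including the empty one), and $V(M)$ is the set of vertices covered by the matching $M$. -}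

module Defs where

open import Level using (Level)
open import Data.Bool using (Bool; true; false; if_then_else_; _∧_)
open import Data.Nat using (ℕ; zero; suc; _≤ᵇ_) renaming (_+_ to _+ℕ_)
open import Data.Fin using (Fin; _≟_)
open import Data.Product using (_×_; _,_; proj₁; proj₂)
open import Data.Vec using (Vec; []; _∷_)
open import Data.List using (List; []; _∷_; map; concatMap; allFin; filterᵇ; foldr)
open import Relation.Nullary.Decidable using (isYes)
open import Algebra.Bundles using (CommutativeRing)

-- A finite (multi)graph on vertex set Fin n with m edges, given by
-- `ends : Vec (Fin n × Fin n) m`; edge i has endpoints
-- proj₁ (ends i) and proj₂ (ends i).  Looplessness is a hypothesis of
-- the theorem.  Edge i has two half-edges: (i , first side) at
-- proj₁ (ends i) and (i , second side) at proj₂ (ends i).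

allVecs : ∀ {a} {A : Set a} → List A → (m : ℕ) → List (Vec A m)
allVecs xs zero    = [] ∷ []
allVecs xs (suc m) = concatMap (λ x → map (x ∷_) (allVecs xs m)) xs

bools : List Bool
bools = false ∷ true ∷ []

pairs : List (Bool × Bool)
pairs = concatMap (λ b → map (b ,_) bools) bools

b2n : Bool → ℕ
b2n true  = 1
b2n false = 0

_==_ : ∀ {n} → Fin n → Fin n → Bool
x == y = isYes (x ≟ y)

degree : ∀ {n m} → Vec (Fin n × Fin n) m → Fin n → ℕ
degree []            v = 0
degree ((x , y) ∷ es) v = b2n (x == v) +ℕ b2n (y == v) +ℕ degree es v

HalfSubset : ℕ → Set
HalfSubset m = Vec (Bool × Bool) m

allHalfSubsets : (m : ℕ) → List (HalfSubset m)
allHalfSubsets m = allVecs pairs m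

chosenAt : ∀ {n m} → Vec (Fin n × Fin n) m → HalfSubset m → Fin n → ℕ
chosenAt []             []             v = 0
chosenAt ((x , y) ∷ es) ((p , q) ∷ cs) v =
  b2n (p ∧ (x == v)) +ℕ b2n (q ∧ (y == v)) +ℕ chosenAt es cs v

allB : ∀ {n} → (Fin n → Bool) → Bool
allB {n} f = foldr (λ v b → f v ∧ b) true (allFin n)

isConfig : ∀ {n m} → Vec (Fin n × Fin n) m → HalfSubset m → Bool
isConfig es c = allB (λ v → chosenAt es c v ≤ᵇ 1)

configs : ∀ {n m} → Vec (Fin n × Fin n) m → List (HalfSubset m)
configs {m = m} es = filterᵇ (isConfig es) (allHalfSubsets m)

C₀ C₁ C₂ : ∀ {m} → HalfSubset m → ℕ
C₀ [] = 0
C₀ ((false , false) ∷ cs) = suc (C₀ cs)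
C₀ (_ ∷ cs) = C₀ cs
C₁ [] = 0
C₁ ((true , false) ∷ cs) = suc (C₁ cs)
C₁ ((false , true) ∷ cs) = suc (C₁ cs)
C₁ (_ ∷ cs) = C₁ cs
C₂ [] = 0
C₂ ((true , true) ∷ cs) = suc (C₂ cs)
C₂ (_ ∷ cs) = C₂ cs

EdgeSubset : ℕ → Set
EdgeSubset m = Vec Bool m

coveredCount : ∀ {n m} → Vec (Fin n × Fin n) m → EdgeSubset m → Fin n → ℕ
coveredCount []             []       v = 0
coveredCount ((x , y) ∷ es) (b ∷ bs) v =
  b2n (b ∧ (isYes (x ≟ v) Data.Bool.∨ isYes (y ≟ v))) +ℕ coveredCount es bs v

isMatching : ∀ {n m} → Vec (Fin n × Fin n) m → EdgeSubset m → Bool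
isMatching es M = allB (λ v → coveredCount es M v ≤ᵇ 1)

matchings : ∀ {n m} → Vec (Fin n × Fin n) m → List (EdgeSubset m)
matchings {m = m} es = filterᵇ (isMatching es) (allVecs bools m)

size : ∀ {m} → EdgeSubset m → ℕ
size []       = 0
size (b ∷ bs) = b2n b +ℕ size bs

covered : ∀ {n m} → Vec (Fin n × Fin n) m → EdgeSubset m → Fin n → Bool
covered es M v = Data.Bool.not (coveredCount es M v ≤ᵇ 0)

module Poly {c ℓ : Level} (R : CommutativeRing c ℓ) where
  open CommutativeRing R

  pow : Carrier → ℕ → Carrier
  pow x zero    = 1#
  pow x (suc k) = x * pow x k

  times : ℕ → Carrier → Carrier
  times zero    x = 0#
  times (suc k) x = x + times k x

  sumL : ∀ {a} {A : Set a} → (A → Carrier) → List A → Carrier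
  sumL f = foldr (λ x s → f x + s) 0#

  prodL : ∀ {a} {A : Set a} → (A → Carrier) → List A → Carrier
  prodL f = foldr (λ x s → f x * s) 1#

  MG : ∀ {n m} → Vec (Fin n × Fin n) m → Carrier → Carrier → Carrier → Carrier
  MG es a₀ a₁ a₂ =
    sumL (λ C → pow a₀ (C₀ C) * pow a₁ (C₁ C) * pow a₂ (C₂ C)) (configs es)

  matchingSum : ∀ {n m} → Vec (Fin n × Fin n) m → Carrier → Carrier → Carrier → Carrier
  matchingSum {n} es a₀ a₁ a₂ =
    sumL (λ M → pow (a₀ * a₂ - a₁ * a₁) (size M)
               * prodL (λ v → a₀ + times (degree es v) a₁)
                       (filterᵇ (λ v → Data.Bool.not (covered es M v)) (allFin n)))
         (matchings es)

-- Delete the edges one at a time, remembering in an occupancy u how many chosen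
-- half-edges already meet each vertex.  With vacancy u = a₀^(number of free vertices)
-- and t = a₀a₂ − a₁², the invariant is
--   vacancy u · Σ_{C compatible with u} a₀^C₀ a₁^C₁ a₂^C₂
--     = a₀^|E| · Σ_{M compatible with u} t^|M| ∏_{v free} (a₀ + d_v a₁).
-- Deleting an edge xy splits the left side by which halves of xy are chosen, and the
-- right side by whether xy ∈ M.  If xy ∉ M it still adds a₁ to the weights of x and y;
-- these weights are affine, and expanding them yields the same four occupancy patterns
-- as on the left.  Every newly occupied vertex costs the vacancy a factor a₀, and the
-- pattern with both halves chosen matches because a₀a₂ = a₁² + t.

module Submission where

open import Defs
open import Level using (Level)
open import Function using (_∘_)
open import Data.Nat using (ℕ; zero; suc; _≤_; _<_; _≤ᵇ_; s≤s; z≤n) renaming (_+_ to _+ℕ_)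
import Data.Nat.Properties as ℕ
open import Algebra.Properties.CommutativeSemigroup ℕ.+-commutativeSemigroup using ()
  renaming (xy∙z≈xz∙y to +-right-comm)
open import Data.Fin using (Fin; zero; suc; _≟_)
open import Data.Fin.Properties using (suc-injective)
open import Data.Bool using (Bool; true; false; if_then_else_; _∧_; _∨_; not)
open import Data.Bool.Properties using (∧-zeroʳ; not-involutive)
open import Data.Product using (_×_; _,_; proj₁; proj₂)
open import Data.Vec using (Vec; []; _∷_; lookup)
open import Data.List using (List; []; _∷_; map; _++_; foldr; concatMap; allFin; filterᵇ)
open import Data.List.Properties using (foldr-map; map-tabulate)
open import Data.List.Membership.Propositional using (_∈_)
open import Data.List.Membership.Propositional.Properties using (∈-allFin)
open import Data.List.Relation.Unary.Any using (here; there)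
open import Relation.Binary.PropositionalEquality as ≡ using (_≡_; _≢_; _≗_)
open import Relation.Nullary using (yes; no)
open import Relation.Nullary.Decidable using (isYes≗does; dec-true; dec-false)
open import Algebra.Bundles using (CommutativeRing)

==-refl : ∀ {n} (v : Fin n) → (v == v) ≡ true
==-refl v = ≡.trans (isYes≗does (v ≟ v)) (dec-true (v ≟ v) ≡.refl)

==-false : ∀ {n} {z v : Fin n} → z ≢ v → (z == v) ≡ false
==-false {z = z} {v} z≢v = ≡.trans (isYes≗does (z ≟ v)) (dec-false (z ≟ v) z≢v)

==-∧-false : ∀ {n} {x y : Fin n} → x ≢ y → ∀ v → (x == v ∧ y == v) ≡ false
==-∧-false {x = x} {y} x≢y v with x ≟ v
... | yes ≡.refl = ==-false (x≢y ∘ ≡.sym)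
... | no _ = ≡.refl

b2n-∨ : ∀ p q → p ∧ q ≡ false → b2n (p ∨ q) ≡ b2n p +ℕ b2n q
b2n-∨ true  false _ = ≡.refl
b2n-∨ false q     _ = ≡.refl

foldr-∧-cong : ∀ {a} {A : Set a} {f g : A → Bool} → (∀ v → f v ≡ g v) → (xs : List A) →
  foldr (λ v b → f v ∧ b) true xs ≡ foldr (λ v b → g v ∧ b) true xs
foldr-∧-cong f≗g []       = ≡.refl
foldr-∧-cong f≗g (x ∷ xs) = ≡.cong₂ _∧_ (f≗g x) (foldr-∧-cong f≗g xs)

foldr-∧-false : ∀ {a} {A : Set a} (f : A → Bool) {z : A} {xs : List A} →
  z ∈ xs → f z ≡ false → foldr (λ v b → f v ∧ b) true xs ≡ false
foldr-∧-false f (here ≡.refl) fz≡false rewrite fz≡false = ≡.refl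
foldr-∧-false f {xs = x ∷ _} (there z∈xs) fz≡false
  rewrite foldr-∧-false f z∈xs fz≡false = ∧-zeroʳ (f x)

allB-cong : ∀ {n} {f g : Fin n → Bool} → (∀ v → f v ≡ g v) → allB f ≡ allB g
allB-cong {n} f≗g = foldr-∧-cong f≗g (allFin n)

allB-false : ∀ {n} (f : Fin n → Bool) (z : Fin n) → f z ≡ false → allB f ≡ false
allB-false f z = foldr-∧-false f (∈-allFin z)

EdgeList : ℕ → ℕ → Set
EdgeList n m = Vec (Fin n × Fin n) m

Loopless : ∀ {n m} → EdgeList n m → Set
Loopless {m = m} es = (i : Fin m) → proj₁ (lookup es i) ≢ proj₂ (lookup es i)

Occupancy : ℕ → Set
Occupancy n = Fin n → ℕ

occupy : ∀ {n} → Fin n → Occupancy n → Occupancy n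
occupy z u v = u v +ℕ b2n (z == v)

_⊕_ : ∀ {n} → Occupancy n → Occupancy n → Occupancy n
(u ⊕ w) v = u v +ℕ w v

valid : ∀ {n} → Occupancy n → Bool
valid u = allB (λ v → u v ≤ᵇ 1)

occupy-at : ∀ {n} (z : Fin n) (u : Occupancy n) → occupy z u z ≡ suc (u z)
occupy-at z u = ≡.trans (≡.cong (λ b → u z +ℕ b2n b) (==-refl z)) (ℕ.+-comm (u z) 1)

occupy-elsewhere : ∀ {n} {z v : Fin n} (u : Occupancy n) → z ≢ v → occupy z u v ≡ u v
occupy-elsewhere {v = v} u z≢v =
  ≡.trans (≡.cong (λ b → u v +ℕ b2n b) (==-false z≢v)) (ℕ.+-identityʳ (u v))

≤-occupy : ∀ {n} (z v : Fin n) (u : Occupancy n) → u v ≤ occupy z u v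
≤-occupy z v u = ℕ.m≤m+n (u v) (b2n (z == v))

<-occupy : ∀ {n} (z : Fin n) (u : Occupancy n) → u z < occupy z u z
<-occupy z u = ℕ.≤-reflexive (≡.sym (occupy-at z u))

occupy-comm : ∀ {n} (x y : Fin n) (u : Occupancy n) → occupy x (occupy y u) ≗ occupy y (occupy x u)
occupy-comm x y u v = +-right-comm (u v) (b2n (y == v)) (b2n (x == v))

occupy-⊕ : ∀ {n} (z : Fin n) (u w : Occupancy n) → occupy z (u ⊕ w) ≗ occupy z u ⊕ w
occupy-⊕ z u w v = +-right-comm (u v) (w v) (b2n (z == v))

⊕-occupy₂ : ∀ {n} (x y : Fin n) (u w : Occupancy n) v →
  u v +ℕ ((b2n (x == v) +ℕ b2n (y == v)) +ℕ w v) ≡ (occupy y (occupy x u) ⊕ w) v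
⊕-occupy₂ x y u w v =
  ≡.trans (≡.sym (ℕ.+-assoc (u v) _ (w v))) (≡.cong (_+ℕ w v) (≡.sym (ℕ.+-assoc (u v) _ _)))

valid-cong : ∀ {n} {u w : Occupancy n} → u ≗ w → valid u ≡ valid w
valid-cong u≗w = allB-cong (λ v → ≡.cong (_≤ᵇ 1) (u≗w v))

valid-overfull : ∀ {n} (u : Occupancy n) (z : Fin n) → 2 ≤ u z → valid u ≡ false
valid-overfull u z 2≤uz = allB-false _ z (at 2≤uz)
  where
  at : ∀ {k} → 2 ≤ k → (k ≤ᵇ 1) ≡ false
  at (s≤s (s≤s _)) = ≡.refl

valid-occupy-vacant : ∀ {n} (z : Fin n) (u : Occupancy n) → u z ≡ 0 → valid (occupy z u) ≡ valid u
valid-occupy-vacant z u uz≡0 = allB-cong at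
  where
  at : ∀ v → (occupy z u v ≤ᵇ 1) ≡ (u v ≤ᵇ 1)
  at v with z ≟ v
  ... | yes ≡.refl rewrite uz≡0 = ≡.refl
  ... | no _ = ≡.cong (_≤ᵇ 1) (ℕ.+-identityʳ (u v))

module ListSums {c ℓ : Level} (R : CommutativeRing c ℓ) where
  open CommutativeRing R hiding (zero)
  open Poly R
  open import Relation.Binary.Reasoning.Setoid setoid
  open import Algebra.Properties.CommutativeSemigroup +-commutativeSemigroup using (interchange)
  open import Algebra.Solver.Ring.NaturalCoefficients.Default commutativeSemiring
    using (solve; _:*_; _:=_)

  module _ {a} {A : Set a} where

    sumL-cong : {f g : A → Carrier} (xs : List A) → (∀ x → f x ≈ g x) → sumL f xs ≈ sumL g xs
    sumL-cong []       f≈g = refl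
    sumL-cong (x ∷ xs) f≈g = +-cong (f≈g x) (sumL-cong xs f≈g)

    prodL-cong : {f g : A → Carrier} (xs : List A) → (∀ x → f x ≈ g x) → prodL f xs ≈ prodL g xs
    prodL-cong []       f≈g = refl
    prodL-cong (x ∷ xs) f≈g = *-cong (f≈g x) (prodL-cong xs f≈g)

    sumL-zero : {f : A → Carrier} (xs : List A) → (∀ x → f x ≈ 0#) → sumL f xs ≈ 0#
    sumL-zero []       f≈0 = refl
    sumL-zero (x ∷ xs) f≈0 = trans (+-cong (f≈0 x) (sumL-zero xs f≈0)) (+-identityʳ 0#)

    sumL-++ : (f : A → Carrier) (xs ys : List A) → sumL f (xs ++ ys) ≈ sumL f xs + sumL f ys
    sumL-++ f []       ys = sym (+-identityˡ _)
    sumL-++ f (x ∷ xs) ys = trans (+-congˡ (sumL-++ f xs ys)) (sym (+-assoc _ _ _))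

    sumL-+ : (f g : A → Carrier) (xs : List A) → sumL (λ x → f x + g x) xs ≈ sumL f xs + sumL g xs
    sumL-+ f g []       = sym (+-identityˡ 0#)
    sumL-+ f g (x ∷ xs) = trans (+-congˡ (sumL-+ f g xs)) (interchange (f x) (g x) (sumL f xs) (sumL g xs))

    sumL-*ˡ : (k : Carrier) (f : A → Carrier) (xs : List A) → k * sumL f xs ≈ sumL (λ x → k * f x) xs
    sumL-*ˡ k f []       = zeroʳ k
    sumL-*ˡ k f (x ∷ xs) = trans (distribˡ k _ _) (+-congˡ (sumL-*ˡ k f xs))

    sumL-filterᵇ : (f : A → Carrier) (P : A → Bool) (xs : List A) →
      sumL f (filterᵇ P xs) ≈ sumL (λ x → if P x then f x else 0#) xs
    sumL-filterᵇ f P []       = refl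
    sumL-filterᵇ f P (x ∷ xs) with P x
    ... | true  = +-congˡ (sumL-filterᵇ f P xs)
    ... | false = trans (sumL-filterᵇ f P xs) (sym (+-identityˡ _))

    prodL-filterᵇ : (f : A → Carrier) (P : A → Bool) (xs : List A) →
      prodL f (filterᵇ P xs) ≈ prodL (λ x → if P x then f x else 1#) xs
    prodL-filterᵇ f P []       = refl
    prodL-filterᵇ f P (x ∷ xs) with P x
    ... | true  = *-congˡ (prodL-filterᵇ f P xs)
    ... | false = trans (prodL-filterᵇ f P xs) (sym (*-identityˡ _))

  module _ {a b} {A : Set a} {B : Set b} where

    sumL-map : (f : B → Carrier) (g : A → B) (xs : List A) → sumL f (map g xs) ≡ sumL (f ∘ g) xs
    sumL-map f g = foldr-map (λ y s → f y + s) g 0#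

    prodL-map : (f : B → Carrier) (g : A → B) (xs : List A) → prodL f (map g xs) ≡ prodL (f ∘ g) xs
    prodL-map f g = foldr-map (λ y s → f y * s) g 1#

    sumL-concatMap : (h : B → Carrier) (g : A → List B) (xs : List A) →
      sumL h (concatMap g xs) ≈ sumL (λ x → sumL h (g x)) xs
    sumL-concatMap h g []       = refl
    sumL-concatMap h g (x ∷ xs) = trans (sumL-++ h (g x) _) (+-congˡ (sumL-concatMap h g xs))

  sumL-allVecs : ∀ {a} {A : Set a} (xs : List A) (m : ℕ) (h : Vec A (suc m) → Carrier) →
    sumL h (allVecs xs (suc m)) ≈ sumL (λ x → sumL (λ c → h (x ∷ c)) (allVecs xs m)) xs
  sumL-allVecs xs m h = trans (sumL-concatMap h (λ x → map (x ∷_) (allVecs xs m)) xs)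
    (sumL-cong xs (λ x → reflexive (sumL-map h (x ∷_) (allVecs xs m))))

  prodL-allFin-suc : ∀ {n} (f : Fin (suc n) → Carrier) →
    prodL f (allFin (suc n)) ≡ f zero * prodL (f ∘ suc) (allFin n)
  prodL-allFin-suc {n} f = ≡.cong (f zero *_)
    (≡.trans (≡.cong (prodL f) (≡.sym (map-tabulate (λ i → i) suc))) (prodL-map f suc (allFin n)))

  prodL-const : ∀ n (k : Carrier) → prodL (λ _ → k) (allFin n) ≈ pow k n
  prodL-const zero    k = refl
  prodL-const (suc n) k = trans (reflexive (prodL-allFin-suc {n} (λ _ → k))) (*-congˡ (prodL-const n k))

  prodL-exchange : ∀ {n} (f g : Fin n → Carrier) (z : Fin n) → (∀ v → z ≢ v → f v ≈ g v) →
    prodL f (allFin n) * g z ≈ prodL g (allFin n) * f z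
  prodL-exchange {suc n} f g zero agree = begin
    prodL f (allFin (suc n)) * g zero               ≡⟨ ≡.cong (_* g zero) (prodL-allFin-suc f) ⟩
    f zero * prodL (f ∘ suc) (allFin n) * g zero
      ≈⟨ *-congʳ (*-congˡ (prodL-cong (allFin n) (λ v → agree (suc v) (λ ())))) ⟩
    f zero * prodL (g ∘ suc) (allFin n) * g zero
      ≈⟨ solve 3 (λ a p b → a :* p :* b := b :* p :* a) refl (f zero) _ (g zero) ⟩
    g zero * prodL (g ∘ suc) (allFin n) * f zero    ≡⟨ ≡.cong (_* f zero) (prodL-allFin-suc g) ⟨
    prodL g (allFin (suc n)) * f zero               ∎
  prodL-exchange {suc n} f g (suc z) agree = begin
    prodL f (allFin (suc n)) * g (suc z)              ≡⟨ ≡.cong (_* g (suc z)) (prodL-allFin-suc f) ⟩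
    f zero * prodL (f ∘ suc) (allFin n) * g (suc z)   ≈⟨ *-assoc _ _ _ ⟩
    f zero * (prodL (f ∘ suc) (allFin n) * g (suc z))
      ≈⟨ *-cong (agree zero (λ ()))
                (prodL-exchange (f ∘ suc) (g ∘ suc) z (λ v z≢v → agree (suc v) (z≢v ∘ suc-injective))) ⟩
    g zero * (prodL (g ∘ suc) (allFin n) * f (suc z)) ≈⟨ *-assoc _ _ _ ⟨
    g zero * prodL (g ∘ suc) (allFin n) * f (suc z)   ≡⟨ ≡.cong (_* f (suc z)) (prodL-allFin-suc g) ⟨
    prodL g (allFin (suc n)) * f (suc z)              ∎

  times-+ : ∀ i j (k : Carrier) → times (i +ℕ j) k ≈ times i k + times j k
  times-+ zero    j k = sym (+-identityˡ _)
  times-+ (suc i) j k = trans (+-congˡ (times-+ i j k)) (sym (+-assoc _ _ _))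

module HalfEdgeExpansion {c ℓ : Level} (R : CommutativeRing c ℓ)
  (a₀ a₁ a₂ : CommutativeRing.Carrier R) where
  open CommutativeRing R hiding (zero)
  open Poly R
  open ListSums R
  open import Relation.Binary.Reasoning.Setoid setoid
  open import Algebra.Properties.AbelianGroup +-abelianGroup using (xyx⁻¹≈y)
  open import Algebra.Solver.Ring.NaturalCoefficients.Default commutativeSemiring
    using (solve; _:+_; _:*_; _:=_)

  infix 8 [_]·_
  [_]·_ : Bool → Carrier → Carrier
  [ b ]· x = if b then x else 0#

  []·-cong : ∀ {b b′ x y} → b ≡ b′ → x ≈ y → [ b ]· x ≈ [ b′ ]· y
  []·-cong {true}  ≡.refl x≈y = x≈y
  []·-cong {false} ≡.refl _   = refl

  []·-*ˡ : ∀ b k x → [ b ]· (k * x) ≈ k * [ b ]· x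
  []·-*ˡ true  k x = refl
  []·-*ˡ false k x = sym (zeroʳ k)

  []·-+ : ∀ b x y → [ b ]· (x + y) ≈ [ b ]· x + [ b ]· y
  []·-+ true  x y = refl
  []·-+ false x y = sym (+-identityʳ 0#)

  addAt : ∀ {n} → Fin n → Carrier → (Fin n → Carrier) → Fin n → Carrier
  addAt z k α v = α v + times (b2n (z == v)) k

  addAt-at : ∀ {n} (z : Fin n) k α → addAt z k α z ≈ α z + k
  addAt-at z k α rewrite ==-refl z = +-congˡ (+-identityʳ k)

  addAt-elsewhere : ∀ {n} {z v : Fin n} k α → z ≢ v → addAt z k α v ≈ α v
  addAt-elsewhere {v = v} k α z≢v rewrite ==-false z≢v = +-identityʳ (α v)

  freeFactor : ∀ {n} → (Fin n → Carrier) → Occupancy n → Fin n → Carrier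
  freeFactor α u v = if u v ≤ᵇ 0 then α v else 1#

  freeProd : ∀ {n} → (Fin n → Carrier) → Occupancy n → Carrier
  freeProd {n} α u = prodL (freeFactor α u) (allFin n)

  freeTerm : ∀ {n} → (Fin n → Carrier) → Occupancy n → Carrier
  freeTerm α u = [ valid u ]· freeProd α u

  freeFactor-cong : ∀ {n} {α β : Fin n → Carrier} {u w : Occupancy n} v →
    u v ≡ w v → (w v ≡ 0 → α v ≈ β v) → freeFactor α u v ≈ freeFactor β w v
  freeFactor-cong {w = w} v uv≡wv α≈β rewrite uv≡wv with w v in wv
  ... | zero  = α≈β ≡.refl
  ... | suc _ = refl

  freeProd-cong : ∀ {n} {α β : Fin n → Carrier} {u w : Occupancy n} →
    (∀ v → w v ≡ 0 → α v ≈ β v) → u ≗ w → freeProd α u ≈ freeProd β w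
  freeProd-cong {α = α} {β} {u} {w} α≈β u≗w =
    prodL-cong (allFin _) (λ v → freeFactor-cong {α = α} {β} {u} {w} v (u≗w v) (α≈β v))

  freeTerm-cong : ∀ {n} {α β : Fin n → Carrier} (u w : Occupancy n) →
    (∀ v → w v ≡ 0 → α v ≈ β v) → u ≗ w → freeTerm α u ≈ freeTerm β w
  freeTerm-cong u w α≈β u≗w = []·-cong (valid-cong u≗w) (freeProd-cong α≈β u≗w)

  freeProd-occupy : ∀ {n} (β α : Fin n → Carrier) (u : Occupancy n) (z : Fin n) → u z ≡ 0 →
    (∀ v → z ≢ v → β v ≈ α v) → freeProd β u ≈ β z * freeProd α (occupy z u)
  freeProd-occupy β α u z uz≡0 agree = begin
    freeProd β u                                         ≈⟨ *-identityʳ _ ⟨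
    freeProd β u * 1#                                    ≈⟨ *-congˡ (reflexive occupiedFactor) ⟨
    freeProd β u * freeFactor α (occupy z u) z
      ≈⟨ prodL-exchange _ _ z (λ v z≢v → freeFactor-cong {α = β} {α} {u} {occupy z u} v
                                            (≡.sym (occupy-elsewhere u z≢v)) (λ _ → agree v z≢v)) ⟩
    freeProd α (occupy z u) * freeFactor β u z           ≈⟨ *-congˡ (reflexive vacantFactor) ⟩
    freeProd α (occupy z u) * β z                        ≈⟨ *-comm _ _ ⟩
    β z * freeProd α (occupy z u)                        ∎
    where
    occupiedFactor : freeFactor α (occupy z u) z ≡ 1#
    occupiedFactor rewrite occupy-at z u = ≡.refl
    vacantFactor : freeFactor β u z ≡ β z
    vacantFactor rewrite uz≡0 = ≡.refl

  freeProd-addAt-vacant : ∀ {n} (z : Fin n) k α (w : Occupancy n) → w z ≡ 0 →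
    freeProd (addAt z k α) w ≈ freeProd α w + k * freeProd α (occupy z w)
  freeProd-addAt-vacant z k α w wz≡0 = begin
    freeProd (addAt z k α) w
      ≈⟨ freeProd-occupy (addAt z k α) α w z wz≡0 (λ v → addAt-elsewhere k α) ⟩
    addAt z k α z * freeProd α (occupy z w) ≈⟨ *-congʳ (addAt-at z k α) ⟩
    (α z + k) * freeProd α (occupy z w)     ≈⟨ distribʳ _ _ _ ⟩
    α z * freeProd α (occupy z w) + k * freeProd α (occupy z w)
      ≈⟨ +-congʳ (freeProd-occupy α α w z wz≡0 (λ _ _ → refl)) ⟨
    freeProd α w + k * freeProd α (occupy z w) ∎

  freeProd-addAt-occupied : ∀ {n} (z : Fin n) k α (w : Occupancy n) → w z ≢ 0 →
    freeProd (addAt z k α) w ≈ freeProd α w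
  freeProd-addAt-occupied z k α w wz≢0 = freeProd-cong agree (λ _ → ≡.refl)
    where
    agree : ∀ v → w v ≡ 0 → addAt z k α v ≈ α v
    agree v wv≡0 = addAt-elsewhere {z = z} k α (λ { ≡.refl → wz≢0 wv≡0 })

  -- The extra k is paid either by z staying free or by z becoming occupied,
  -- which kills the term if z already was.
  freeTerm-addAt : ∀ {n} (z : Fin n) k α (w : Occupancy n) →
    freeTerm (addAt z k α) w ≈ freeTerm α w + k * freeTerm α (occupy z w)
  freeTerm-addAt z k α w with w z in wz
  ... | zero = begin
    [ valid w ]· freeProd (addAt z k α) w
      ≈⟨ []·-cong ≡.refl (freeProd-addAt-vacant z k α w wz) ⟩
    [ valid w ]· (freeProd α w + k * freeProd α (occupy z w))
      ≈⟨ []·-+ (valid w) _ _ ⟩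
    [ valid w ]· freeProd α w + [ valid w ]· (k * freeProd α (occupy z w))
      ≈⟨ +-congˡ ([]·-*ˡ (valid w) k _) ⟩
    freeTerm α w + k * [ valid w ]· freeProd α (occupy z w)
      ≈⟨ +-congˡ (*-congˡ ([]·-cong (≡.sym (valid-occupy-vacant z w wz)) refl)) ⟩
    freeTerm α w + k * freeTerm α (occupy z w) ∎
  ... | suc j = begin
    [ valid w ]· freeProd (addAt z k α) w
      ≈⟨ []·-cong ≡.refl (freeProd-addAt-occupied z k α w λ wz≡0 → ℕ.0≢1+n (≡.trans (≡.sym wz≡0) wz)) ⟩
    freeTerm α w                      ≈⟨ +-identityʳ _ ⟨
    freeTerm α w + 0#                 ≈⟨ +-congˡ (zeroʳ k) ⟨
    freeTerm α w + k * 0#             ≈⟨ +-congˡ (*-congˡ ([]·-cong overfull refl)) ⟨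
    freeTerm α w + k * freeTerm α (occupy z w) ∎
    where
    overfull : valid (occupy z w) ≡ false
    overfull = valid-overfull (occupy z w) z
      (≡.subst (2 ≤_) (≡.sym (≡.trans (occupy-at z w) (≡.cong suc wz))) (s≤s (s≤s z≤n)))

  weight : ∀ {m} → HalfSubset m → Carrier
  weight C = pow a₀ (C₀ C) * pow a₁ (C₁ C) * pow a₂ (C₂ C)

  configSum : ∀ {n m} → EdgeList n m → Occupancy n → Carrier
  configSum {m = m} es u = sumL (λ C → [ valid (u ⊕ chosenAt es C) ]· weight C) (allHalfSubsets m)

  configSum-overfull : ∀ {n m} (es : EdgeList n m) (u : Occupancy n) (z : Fin n) →
    2 ≤ u z → configSum es u ≈ 0#
  configSum-overfull {m = m} es u z 2≤uz = sumL-zero (allHalfSubsets m) λ C →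
    []·-cong (valid-overfull (u ⊕ chosenAt es C) z (ℕ.≤-trans 2≤uz (ℕ.m≤m+n (u z) _))) refl

  configSum-∷ : ∀ {n m} (x y : Fin n) (es : EdgeList n m) (u : Occupancy n) →
    configSum ((x , y) ∷ es) u ≈
      a₀ * configSum es u + (a₁ * configSum es (occupy y u) +
        (a₁ * configSum es (occupy x u) + a₂ * configSum es (occupy y (occupy x u))))
  configSum-∷ {m = m} x y es u = begin
    configSum ((x , y) ∷ es) u ≈⟨ sumL-allVecs pairs m _ ⟩
    halves (false , false) + (halves (false , true) + (halves (true , false) + (halves (true , true) + 0#)))
      ≈⟨ +-cong none (+-cong second (+-cong first (trans (+-identityʳ _) both))) ⟩
    a₀ * configSum es u + (a₁ * configSum es (occupy y u) +
      (a₁ * configSum es (occupy x u) + a₂ * configSum es (occupy y (occupy x u)))) ∎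
    where
    halves : Bool × Bool → Carrier
    halves p = sumL (λ C → [ valid (u ⊕ chosenAt ((x , y) ∷ es) (p ∷ C)) ]· weight (p ∷ C)) (allHalfSubsets m)

    halves≈ : ∀ p k w → (∀ C → u ⊕ chosenAt ((x , y) ∷ es) (p ∷ C) ≗ w ⊕ chosenAt es C) →
      (∀ C → weight (p ∷ C) ≈ k * weight C) → halves p ≈ k * configSum es w
    halves≈ p k w occ wt = begin
      halves p ≈⟨ sumL-cong (allHalfSubsets m) (λ C → []·-cong (valid-cong (occ C)) (wt C)) ⟩
      sumL (λ C → [ valid (w ⊕ chosenAt es C) ]· (k * weight C)) (allHalfSubsets m)
        ≈⟨ sumL-cong (allHalfSubsets m) (λ C → []·-*ˡ _ k _) ⟩
      sumL (λ C → k * [ valid (w ⊕ chosenAt es C) ]· weight C) (allHalfSubsets m)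
        ≈⟨ sumL-*ˡ k _ (allHalfSubsets m) ⟨
      k * configSum es w ∎

    none : halves (false , false) ≈ a₀ * configSum es u
    none = halves≈ (false , false) a₀ u (λ _ _ → ≡.refl)
      (λ _ → solve 4 (λ a p q r → a :* p :* q :* r := a :* (p :* q :* r)) refl a₀ _ _ _)

    second : halves (false , true) ≈ a₁ * configSum es (occupy y u)
    second = halves≈ (false , true) a₁ (occupy y u) (λ _ v → ≡.sym (ℕ.+-assoc (u v) _ _))
      (λ _ → solve 4 (λ a p q r → p :* (a :* q) :* r := a :* (p :* q :* r)) refl a₁ _ _ _)

    first : halves (true , false) ≈ a₁ * configSum es (occupy x u)
    first = halves≈ (true , false) a₁ (occupy x u)
      (λ C v → ≡.trans (≡.cong (λ k → u v +ℕ (k +ℕ chosenAt es C v)) (ℕ.+-identityʳ _))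
                       (≡.sym (ℕ.+-assoc (u v) _ _)))
      (λ _ → solve 4 (λ a p q r → p :* (a :* q) :* r := a :* (p :* q :* r)) refl a₁ _ _ _)

    both : halves (true , true) ≈ a₂ * configSum es (occupy y (occupy x u))
    both = halves≈ (true , true) a₂ (occupy y (occupy x u)) (λ C → ⊕-occupy₂ x y u (chosenAt es C))
      (λ _ → solve 4 (λ a p q r → p :* q :* (a :* r) := a :* (p :* q :* r)) refl a₂ _ _ _)

  t : Carrier
  t = a₀ * a₂ - a₁ * a₁

  withDegrees : ∀ {n m} → EdgeList n m → (Fin n → Carrier) → Fin n → Carrier
  withDegrees es α v = α v + times (degree es v) a₁

  matchingTerm : ∀ {n m} → EdgeList n m → (Fin n → Carrier) → Occupancy n → EdgeSubset m → Carrier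
  matchingTerm es α u M = pow t (size M) * freeTerm (withDegrees es α) (u ⊕ coveredCount es M)

  matchingSumFrom : ∀ {n m} → EdgeList n m → (Fin n → Carrier) → Occupancy n → Carrier
  matchingSumFrom {m = m} es α u = sumL (matchingTerm es α u) (allVecs bools m)

  matchingSumFrom-cong : ∀ {n m} (es : EdgeList n m) α {u w : Occupancy n} → u ≗ w →
    matchingSumFrom es α u ≈ matchingSumFrom es α w
  matchingSumFrom-cong {m = m} es α u≗w = sumL-cong (allVecs bools m) λ M →
    *-congˡ (freeTerm-cong _ _ (λ _ _ → refl) (λ v → ≡.cong (_+ℕ coveredCount es M v) (u≗w v)))

  matchingTerm-addAt : ∀ {n m} (es : EdgeList n m) (z : Fin n) k α (u : Occupancy n) M →
    matchingTerm es (addAt z k α) u M ≈ matchingTerm es α u M + k * matchingTerm es α (occupy z u) M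
  matchingTerm-addAt es z k α u M = begin
    p * freeTerm (withDegrees es (addAt z k α)) w
      ≈⟨ *-congˡ (freeTerm-cong w w (λ v _ → degreesFirst v) (λ _ → ≡.refl)) ⟩
    p * freeTerm (addAt z k (withDegrees es α)) w
      ≈⟨ *-congˡ (freeTerm-addAt z k (withDegrees es α) w) ⟩
    p * (freeTerm (withDegrees es α) w + k * freeTerm (withDegrees es α) (occupy z w))
      ≈⟨ *-congˡ (+-congˡ (*-congˡ (freeTerm-cong _ _ (λ _ _ → refl) (occupy-⊕ z u (coveredCount es M))))) ⟩
    p * (freeTerm (withDegrees es α) w + k * freeTerm (withDegrees es α) (occupy z u ⊕ coveredCount es M))
      ≈⟨ solve 4 (λ p x k y → p :* (x :+ k :* y) := p :* x :+ k :* (p :* y)) refl p _ k _ ⟩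
    matchingTerm es α u M + k * matchingTerm es α (occupy z u) M ∎
    where
    p = pow t (size M)
    w = u ⊕ coveredCount es M
    degreesFirst : ∀ v → withDegrees es (addAt z k α) v ≈ addAt z k (withDegrees es α) v
    degreesFirst v = solve 3 (λ a b c → (a :+ b) :+ c := (a :+ c) :+ b) refl (α v) _ _

  matchingSumFrom-addAt : ∀ {n m} (es : EdgeList n m) (z : Fin n) k α (u : Occupancy n) →
    matchingSumFrom es (addAt z k α) u ≈ matchingSumFrom es α u + k * matchingSumFrom es α (occupy z u)
  matchingSumFrom-addAt {m = m} es z k α u = begin
    matchingSumFrom es (addAt z k α) u
      ≈⟨ sumL-cong (allVecs bools m) (matchingTerm-addAt es z k α u) ⟩
    sumL (λ M → matchingTerm es α u M + k * matchingTerm es α (occupy z u) M) (allVecs bools m)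
      ≈⟨ sumL-+ _ _ (allVecs bools m) ⟩
    matchingSumFrom es α u + sumL (λ M → k * matchingTerm es α (occupy z u) M) (allVecs bools m)
      ≈⟨ +-congˡ (sumL-*ˡ k _ (allVecs bools m)) ⟨
    matchingSumFrom es α u + k * matchingSumFrom es α (occupy z u) ∎

  withDegrees-∷ : ∀ {n m} (x y : Fin n) (es : EdgeList n m) α v →
    withDegrees ((x , y) ∷ es) α v ≈ withDegrees es (addAt y a₁ (addAt x a₁ α)) v
  withDegrees-∷ x y es α v = begin
    α v + times (bx +ℕ by +ℕ degree es v) a₁
      ≈⟨ +-congˡ (trans (times-+ (bx +ℕ by) (degree es v) a₁) (+-congʳ (times-+ bx by a₁))) ⟩
    α v + (times bx a₁ + times by a₁ + times (degree es v) a₁)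
      ≈⟨ solve 4 (λ a p q d → a :+ (p :+ q :+ d) := a :+ p :+ q :+ d) refl (α v) _ _ _ ⟩
    withDegrees es (addAt y a₁ (addAt x a₁ α)) v ∎
    where
    bx = b2n (x == v)
    by = b2n (y == v)

  matchingTerm-skip : ∀ {n m} (x y : Fin n) (es : EdgeList n m) α (u : Occupancy n) M →
    matchingTerm ((x , y) ∷ es) α u (false ∷ M) ≈ matchingTerm es (addAt y a₁ (addAt x a₁ α)) u M
  matchingTerm-skip x y es α u M =
    *-congˡ (freeTerm-cong (u ⊕ coveredCount es M) _ (λ v _ → withDegrees-∷ x y es α v) (λ _ → ≡.refl))

  matchingTerm-take : ∀ {n m} {x y : Fin n} → x ≢ y → (es : EdgeList n m) → ∀ α (u : Occupancy n) M →
    matchingTerm ((x , y) ∷ es) α u (true ∷ M) ≈ t * matchingTerm es α (occupy y (occupy x u)) M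
  matchingTerm-take {x = x} {y} x≢y es α u M =
    trans (*-assoc _ _ _) (*-congˡ (*-congˡ (freeTerm-cong _ (uxy ⊕ coveredCount es M) free occupancy)))
    where
    uxy = occupy y (occupy x u)
    occupancy : u ⊕ coveredCount ((x , y) ∷ es) (true ∷ M) ≗ uxy ⊕ coveredCount es M
    occupancy v = ≡.trans
      (≡.cong (λ k → u v +ℕ (k +ℕ coveredCount es M v)) (b2n-∨ (x == v) (y == v) (==-∧-false x≢y v)))
      (⊕-occupy₂ x y u (coveredCount es M) v)
    free : ∀ v → (uxy ⊕ coveredCount es M) v ≡ 0 →
      withDegrees ((x , y) ∷ es) α v ≈ withDegrees es α v
    free v ≡0 = +-congˡ (reflexive (≡.cong₂ (λ p q → times (p +ℕ q +ℕ degree es v) a₁) x-free y-free))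
      where
      x-free : b2n (x == v) ≡ 0
      x-free = ℕ.m+n≡0⇒n≡0 (u v) (ℕ.m+n≡0⇒m≡0 _ (ℕ.m+n≡0⇒m≡0 _ ≡0))
      y-free : b2n (y == v) ≡ 0
      y-free = ℕ.m+n≡0⇒n≡0 (u v +ℕ b2n (x == v)) (ℕ.m+n≡0⇒m≡0 _ ≡0)

  matchingSumFrom-∷ : ∀ {n m} {x y : Fin n} → x ≢ y → (es : EdgeList n m) → ∀ α (u : Occupancy n) →
    matchingSumFrom ((x , y) ∷ es) α u ≈
      matchingSumFrom es (addAt y a₁ (addAt x a₁ α)) u + t * matchingSumFrom es α (occupy y (occupy x u))
  matchingSumFrom-∷ {m = m} {x} {y} x≢y es α u = begin
    matchingSumFrom ((x , y) ∷ es) α u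
      ≈⟨ sumL-allVecs bools m _ ⟩
    sumL (term ∘ (false ∷_)) Ms + (sumL (term ∘ (true ∷_)) Ms + 0#)
      ≈⟨ +-cong (sumL-cong Ms (matchingTerm-skip x y es α u))
                (trans (+-identityʳ _) (sumL-cong Ms (matchingTerm-take x≢y es α u))) ⟩
    matchingSumFrom es α′ u + sumL (λ M → t * matchingTerm es α uxy M) Ms
      ≈⟨ +-congˡ (sumL-*ˡ t _ Ms) ⟨
    matchingSumFrom es α′ u + t * matchingSumFrom es α uxy ∎
    where
    Ms = allVecs bools m
    term = matchingTerm ((x , y) ∷ es) α u
    α′ = addAt y a₁ (addAt x a₁ α)
    uxy = occupy y (occupy x u)

  matchingSumFrom-∷-expanded : ∀ {n m} {x y : Fin n} → x ≢ y → (es : EdgeList n m) → ∀ α (u : Occupancy n) →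
    matchingSumFrom ((x , y) ∷ es) α u ≈
      (matchingSumFrom es α u + a₁ * matchingSumFrom es α (occupy x u)
        + a₁ * (matchingSumFrom es α (occupy y u) + a₁ * matchingSumFrom es α (occupy y (occupy x u))))
      + t * matchingSumFrom es α (occupy y (occupy x u))
  matchingSumFrom-∷-expanded {x = x} {y} x≢y es α u = trans (matchingSumFrom-∷ x≢y es α u) (+-congʳ (begin
    matchingSumFrom es (addAt y a₁ (addAt x a₁ α)) u
      ≈⟨ matchingSumFrom-addAt es y a₁ _ u ⟩
    matchingSumFrom es (addAt x a₁ α) u + a₁ * matchingSumFrom es (addAt x a₁ α) (occupy y u)
      ≈⟨ +-cong (matchingSumFrom-addAt es x a₁ α u)
                (*-congˡ (trans (matchingSumFrom-addAt es x a₁ α (occupy y u))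
                                (+-congˡ (*-congˡ (matchingSumFrom-cong es α (occupy-comm x y u)))))) ⟩
    matchingSumFrom es α u + a₁ * matchingSumFrom es α (occupy x u)
      + a₁ * (matchingSumFrom es α (occupy y u) + a₁ * matchingSumFrom es α (occupy y (occupy x u))) ∎))

  a₁²+t≈a₀a₂ : a₁ * a₁ + t ≈ a₀ * a₂
  a₁²+t≈a₀a₂ = trans (sym (+-assoc _ _ _)) (xyx⁻¹≈y (a₁ * a₁) (a₀ * a₂))

  vacancy : ∀ {n} → Occupancy n → Carrier
  vacancy = freeProd (λ _ → a₀)

  -- Either z is free in u and contributes a₀ to the vacancy, or z is overfull
  -- in w and the configuration sum vanishes.
  vacancy-occupy : ∀ {n m} (es : EdgeList n m) (u w : Occupancy n) (z : Fin n) → u z < w z →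
    vacancy u * configSum es w ≈ a₀ * (vacancy (occupy z u) * configSum es w)
  vacancy-occupy es u w z uz<wz with u z in uz
  ... | zero  = trans (*-congʳ (freeProd-occupy _ _ u z uz (λ _ _ → refl))) (*-assoc _ _ _)
  ... | suc _ = begin
    vacancy u * configSum es w                   ≈⟨ *-congˡ vanishes ⟩
    vacancy u * 0#                               ≈⟨ zeroʳ _ ⟩
    0#                                           ≈⟨ zeroʳ a₀ ⟨
    a₀ * 0#                                      ≈⟨ *-congˡ (zeroʳ _) ⟨
    a₀ * (vacancy (occupy z u) * 0#)             ≈⟨ *-congˡ (*-congˡ vanishes) ⟨
    a₀ * (vacancy (occupy z u) * configSum es w) ∎
    where
    vanishes : configSum es w ≈ 0#
    vanishes = configSum-overfull es w z (ℕ.≤-trans (s≤s (s≤s z≤n)) uz<wz)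

  edge-deletion-identity : ∀ X R₀ R₁ R₂ R₃ →
    a₀ * (X * R₀) + (a₁ * (a₀ * (X * R₁)) + (a₁ * (a₀ * (X * R₂)) + a₂ * (a₀ * (a₀ * (X * R₃)))))
      ≈ (a₀ * X) * ((R₀ + a₁ * R₂ + a₁ * (R₁ + a₁ * R₃)) + t * R₃)
  edge-deletion-identity X R₀ R₁ R₂ R₃ = begin
    a₀ * (X * R₀) + (a₁ * (a₀ * (X * R₁)) + (a₁ * (a₀ * (X * R₂)) + a₂ * (a₀ * (a₀ * (X * R₃)))))
      ≈⟨ solve 8 (λ a₀ a₁ a₂ X R₀ R₁ R₂ R₃ →
           a₀ :* (X :* R₀) :+ (a₁ :* (a₀ :* (X :* R₁)) :+
             (a₁ :* (a₀ :* (X :* R₂)) :+ a₂ :* (a₀ :* (a₀ :* (X :* R₃)))))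
           := (a₀ :* X) :* (R₀ :+ a₁ :* R₂ :+ a₁ :* R₁) :+ (a₀ :* a₂) :* (a₀ :* X :* R₃))
           refl a₀ a₁ a₂ X R₀ R₁ R₂ R₃ ⟩
    (a₀ * X) * (R₀ + a₁ * R₂ + a₁ * R₁) + (a₀ * a₂) * (a₀ * X * R₃)
      ≈⟨ +-congˡ (*-congʳ a₁²+t≈a₀a₂) ⟨
    (a₀ * X) * (R₀ + a₁ * R₂ + a₁ * R₁) + (a₁ * a₁ + t) * (a₀ * X * R₃)
      ≈⟨ solve 7 (λ a₀X a₁ t R₀ R₁ R₂ R₃ →
           a₀X :* (R₀ :+ a₁ :* R₂ :+ a₁ :* R₁) :+ (a₁ :* a₁ :+ t) :* (a₀X :* R₃)
           := a₀X :* ((R₀ :+ a₁ :* R₂ :+ a₁ :* (R₁ :+ a₁ :* R₃)) :+ t :* R₃))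
           refl (a₀ * X) a₁ t R₀ R₁ R₂ R₃ ⟩
    (a₀ * X) * ((R₀ + a₁ * R₂ + a₁ * (R₁ + a₁ * R₃)) + t * R₃) ∎

  configSum-[] : ∀ {n} (u : Occupancy n) → configSum [] u ≈ [ valid u ]· 1#
  configSum-[] u = trans (+-identityʳ _)
    ([]·-cong (valid-cong (λ v → ℕ.+-identityʳ (u v))) (trans (*-identityʳ _) (*-identityʳ _)))

  matchingSumFrom-[] : ∀ {n} (α : Fin n → Carrier) (u : Occupancy n) → matchingSumFrom [] α u ≈ freeTerm α u
  matchingSumFrom-[] α u = trans (+-identityʳ _)
    (trans (*-identityˡ _) (freeTerm-cong _ u (λ v _ → +-identityʳ (α v)) (λ v → ℕ.+-identityʳ (u v))))

  vacancy-configSum : ∀ {n m} (es : EdgeList n m) → Loopless es → (u : Occupancy n) →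
    vacancy u * configSum es u ≈ pow a₀ m * matchingSumFrom es (λ _ → a₀) u
  vacancy-configSum [] _ u = begin
    vacancy u * configSum [] u                       ≈⟨ *-congˡ (configSum-[] u) ⟩
    vacancy u * [ valid u ]· 1#                      ≈⟨ []·-*ˡ (valid u) _ 1# ⟨
    [ valid u ]· (vacancy u * 1#)                    ≈⟨ []·-cong ≡.refl (*-identityʳ _) ⟩
    freeTerm (λ _ → a₀) u                            ≈⟨ matchingSumFrom-[] _ u ⟨
    matchingSumFrom [] (λ _ → a₀) u                  ≈⟨ *-identityˡ _ ⟨
    1# * matchingSumFrom [] (λ _ → a₀) u             ∎
  vacancy-configSum {m = suc m} ((x , y) ∷ es) loopless u = begin
    vacancy u * configSum ((x , y) ∷ es) u
      ≈⟨ *-congˡ (configSum-∷ x y es u) ⟩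
    vacancy u * (a₀ * L₀ + (a₁ * L₁ + (a₁ * L₂ + a₂ * L₃)))
      ≈⟨ solve 8 (λ V a₀ a₁ a₂ L₀ L₁ L₂ L₃ →
           V :* (a₀ :* L₀ :+ (a₁ :* L₁ :+ (a₁ :* L₂ :+ a₂ :* L₃)))
           := a₀ :* (V :* L₀) :+ (a₁ :* (V :* L₁) :+ (a₁ :* (V :* L₂) :+ a₂ :* (V :* L₃))))
           refl (vacancy u) a₀ a₁ a₂ L₀ L₁ L₂ L₃ ⟩
    a₀ * (vacancy u * L₀) + (a₁ * (vacancy u * L₁) + (a₁ * (vacancy u * L₂) + a₂ * (vacancy u * L₃)))
      ≈⟨ +-cong (*-congˡ (IH u)) (+-cong (*-congˡ edge₁) (+-cong (*-congˡ edge₂) (*-congˡ edge₃))) ⟩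
    a₀ * (X * R₀) + (a₁ * (a₀ * (X * R₁)) + (a₁ * (a₀ * (X * R₂)) + a₂ * (a₀ * (a₀ * (X * R₃)))))
      ≈⟨ edge-deletion-identity X R₀ R₁ R₂ R₃ ⟩
    (a₀ * X) * ((R₀ + a₁ * R₂ + a₁ * (R₁ + a₁ * R₃)) + t * R₃)
      ≈⟨ *-congˡ (matchingSumFrom-∷-expanded (loopless zero) es A u) ⟨
    pow a₀ (suc m) * matchingSumFrom ((x , y) ∷ es) A u ∎
    where
    A : Fin _ → Carrier
    A _ = a₀
    X = pow a₀ m
    uxy = occupy y (occupy x u)
    L₀ = configSum es u
    L₁ = configSum es (occupy y u)
    L₂ = configSum es (occupy x u)
    L₃ = configSum es uxy
    R₀ = matchingSumFrom es A u
    R₁ = matchingSumFrom es A (occupy y u)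
    R₂ = matchingSumFrom es A (occupy x u)
    R₃ = matchingSumFrom es A uxy
    IH : ∀ w → vacancy w * configSum es w ≈ X * matchingSumFrom es A w
    IH = vacancy-configSum es (λ i → loopless (suc i))
    edge₁ : vacancy u * L₁ ≈ a₀ * (X * R₁)
    edge₁ = trans (vacancy-occupy es u (occupy y u) y (<-occupy y u)) (*-congˡ (IH (occupy y u)))
    edge₂ : vacancy u * L₂ ≈ a₀ * (X * R₂)
    edge₂ = trans (vacancy-occupy es u (occupy x u) x (<-occupy x u)) (*-congˡ (IH (occupy x u)))
    edge₃ : vacancy u * L₃ ≈ a₀ * (a₀ * (X * R₃))
    edge₃ = trans (vacancy-occupy es u uxy x (ℕ.<-≤-trans (<-occupy x u) (≤-occupy y x (occupy x u))))
      (*-congˡ (trans (vacancy-occupy es (occupy x u) uxy y (<-occupy y (occupy x u))) (*-congˡ (IH uxy))))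

  MG≈configSum : ∀ {n m} (es : EdgeList n m) → MG es a₀ a₁ a₂ ≈ configSum es (λ _ → 0)
  MG≈configSum {m = m} es = sumL-filterᵇ weight (isConfig es) (allHalfSubsets m)

  matchingSum≈matchingSumFrom : ∀ {n m} (es : EdgeList n m) →
    matchingSum es a₀ a₁ a₂ ≈ matchingSumFrom es (λ _ → a₀) (λ _ → 0)
  matchingSum≈matchingSumFrom {n} {m} es = trans (sumL-filterᵇ _ (isMatching es) (allVecs bools m))
    (sumL-cong (allVecs bools m) λ M →
      trans ([]·-cong ≡.refl (*-congˡ (uncovered M))) ([]·-*ˡ (isMatching es M) _ _))
    where
    uncovered : ∀ M → prodL (withDegrees es (λ _ → a₀)) (filterᵇ (λ v → not (covered es M v)) (allFin n))
                        ≈ freeProd (withDegrees es (λ _ → a₀)) (coveredCount es M)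
    uncovered M = trans (prodL-filterᵇ _ _ (allFin n)) (prodL-cong (allFin n) λ v →
      reflexive (≡.cong (λ b → if b then withDegrees es (λ _ → a₀) v else 1#) (not-involutive _)))

theorem2p3 : {c ℓ : Level} (R : CommutativeRing c ℓ)
    (n m : ℕ) (ends : Vec (Fin n × Fin n) m) →
    ((i : Fin m) → proj₁ (lookup ends i) ≢ proj₂ (lookup ends i)) →
    (a₀ a₁ a₂ : CommutativeRing.Carrier R) →
    CommutativeRing._≈_ R
      (CommutativeRing._*_ R (Poly.pow R a₀ n) (Poly.MG R ends a₀ a₁ a₂))
      (CommutativeRing._*_ R (Poly.pow R a₀ m) (Poly.matchingSum R ends a₀ a₁ a₂))
theorem2p3 R n m ends loopless a₀ a₁ a₂ = begin
  pow a₀ n * MG ends a₀ a₁ a₂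
    ≈⟨ *-cong (sym (prodL-const n a₀)) (MG≈configSum ends) ⟩
  vacancy {n} (λ _ → 0) * configSum ends (λ _ → 0)
    ≈⟨ vacancy-configSum ends loopless (λ _ → 0) ⟩
  pow a₀ m * matchingSumFrom ends (λ _ → a₀) (λ _ → 0)
    ≈⟨ *-congˡ (matchingSum≈matchingSumFrom ends) ⟨
  pow a₀ m * matchingSum ends a₀ a₁ a₂ ∎
  where
  open CommutativeRing R
  open Poly R
  open ListSums R
  open HalfEdgeExpansion R a₀ a₁ a₂
  open import Relation.Binary.Reasoning.Setoid setoid
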